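{- Let $c,c'>0$ be constants, let $\mathcal{C}'$ be a class of graphs having the $\mathcal{O}(n^{c'})$-CS-Separation property, and let $\mathcal{C}$ be a class of graphs at distance $c\cdot\log n$ of $\mathcal{C}'$. Then $\mathcal{C}$ has the $\mathcal{O}(n^{c'+c})$-CS-Separation property.
   Context: A cut of $G$ is a partition $(W,W')$ of $V(G)$; it separates disjoint $K,S$ if $K\subseteq W$, $S\subseteq W'$. A CS-Separator of $G$ is a family of cuts such that every clique $K$ and stable set $S$ with $K\cap S=\emptyset$ are separated by some cut; its size is the number of cuts. A class $\mathcal{D}$ has the $\mathcal{O}(n^k)$-CS-Separation property if there is a constant $A$ such that every $H\in\mathcal{D}$ has a CS-Separator of size at most $A|V(H)|^k$. A class $\mathcal{C}$ is at distance $f(n)$ of a class $\mathcal{C}'$ if for every $G\in\mathcal{C}$ with $|V(G)|=n$ there is $D\subseteq V(G)$ with $|D|\le f(n)$ and $G\setminus D\in\mathcal{C}'$. Here $\log$ is base $2$. -}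

module Defs where

open import Data.Bool using (Bool; true; false)
open import Data.Nat using (ℕ; _+_; _*_; _^_) renaming (_≤_ to _≤ℕ_)
open import Data.Fin using (Fin)
open import Data.Fin.Subset using (Subset; _∈_; _∉_; ∁; ∣_∣)
open import Data.List using (List; length)
open import Data.List.Membership.Propositional using () renaming (_∈_ to _∈L_)
open import Data.Integer using () renaming (∣_∣ to absℤ)
open import Data.Rational using (ℚ; 0ℚ; _≤_; _<_; ↥_; ↧ₙ_) renaming (_+_ to _+ℚ_)
open import Data.Product using (Σ; ∃; ∃-syntax; _×_)
open import Relation.Binary.PropositionalEquality using (_≡_; _≢_)
open import Function.Definitions using (Injective)

record Graph : Set where
  field
    n      : ℕ
    adj    : Fin n → Fin n → Bool
    sym    : ∀ u v → adj u v ≡ adj v u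
    irrefl : ∀ v → adj v v ≡ false
open Graph public

module _ (G : Graph) where
  IsClique : Subset (n G) → Set
  IsClique K = ∀ u v → u ∈ K → v ∈ K → u ≢ v → adj G u v ≡ true

  IsStable : Subset (n G) → Set
  IsStable S = ∀ u v → u ∈ S → v ∈ S → adj G u v ≡ false

  -- A cut (W , W') is represented by W; W' is the complement ∁ W.
  Separates : Subset (n G) → Subset (n G) → Subset (n G) → Set
  Separates W K S = (∀ v → v ∈ K → v ∈ W) × (∀ v → v ∈ S → v ∈ ∁ W)

  IsCSSeparator : List (Subset (n G)) → Set
  IsCSSeparator F =
    ∀ K S → IsClique K → IsStable S → (∀ v → v ∈ K → v ∉ S) →
    ∃[ W ] (W ∈L F × Separates W K S)

-- A positive real number c, given by its upper Dedekind cut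
-- U = { r ∈ ℚ | c < r }.
record PosReal : Set₁ where
  field
    Upper     : ℚ → Set
    upward    : ∀ r s → Upper r → r ≤ s → Upper s
    inhabited : ∃[ r ] Upper r
    rounded   : ∀ r → Upper r → ∃[ s ] (Upper s × s < r)
    positive  : ∃[ q ] (0ℚ < q × (∀ r → Upper r → q ≤ r))
open PosReal public

SumUpper : PosReal → PosReal → ℚ → Set
SumUpper a b t = ∃[ r ] ∃[ s ] (Upper a r × Upper b s × (r +ℚ s) ≤ t)

-- x ≤ A · m ^ e, where e is the real with upper cut U:
-- for every rational p/q > e, x^q ≤ A^q · m^p.
PowBound : (ℚ → Set) → ℕ → ℕ → ℕ → Set
PowBound U A m x = ∀ r → U r → x ^ (↧ₙ r) ≤ℕ A ^ (↧ₙ r) * m ^ absℤ (↥ r)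

-- d ≤ c · log₂ m: for every rational p/q > c, 2^(q·d) ≤ m^p.
LogBound : PosReal → ℕ → ℕ → Set
LogBound c m d = ∀ r → Upper c r → 2 ^ (↧ₙ r * d) ≤ℕ m ^ absℤ (↥ r)

HasCSSeparation : (Graph → Set) → (ℚ → Set) → Set
HasCSSeparation 𝒟 U =
  ∃[ A ] (∀ H → 𝒟 H → ∃[ F ] (IsCSSeparator H F × PowBound U A (n H) (length F)))

IsoToDeletion : Graph → (G : Graph) → Subset (n G) → Set
IsoToDeletion H G D =
  Σ (Fin (n H) → Fin (n G)) λ f →
    Injective _≡_ _≡_ f ×
    (∀ i → f i ∉ D) ×
    (∀ v → v ∉ D → ∃[ i ] (f i ≡ v)) ×
    (∀ i j → adj H i j ≡ adj G (f i) (f j))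

AtLogDistance : (Graph → Set) → (Graph → Set) → PosReal → Set
AtLogDistance 𝒞 𝒞' c =
  ∀ G → 𝒞 G → ∃[ D ] (LogBound c (n G) ∣ D ∣ × ∃[ H ] (𝒞' H × IsoToDeletion H G D))

-- Let G ∈ 𝒞, delete D with |D| ≤ c·log n to obtain H ∈ 𝒞′, and
-- let F be a CS-separator of H. For every cut W ∈ F and every T ⊆ D take the
-- cut T ∪ f(W) of G, where f embeds H as G ∖ D. A pair (K, S) of G is
-- separated by the cut built from the H-cut separating the pulled-back pair
-- and from T = K ∩ D. This family has |F|·2^|D| cuts, and
-- |F| ≤ A·n^c′ together with 2^|D| ≤ n^c gives |F|·2^|D| ≤ A·n^(c′+c).
module Submission where

open import Defs hiding (sym)

open import Data.Empty using (⊥; ⊥-elim)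
open import Data.Fin using (Fin) renaming (_≟_ to _≟ᶠ_)
open import Data.Fin.Properties using (any?; injective⇒≤)
open import Data.Fin.Subset using (Subset; inside; outside; _∈_; _∉_; ∁; ∣_∣; _∩_; _∪_)
open import Data.Fin.Subset.Properties
  using (_∈?_; x∈p∩q⁺; x∈p∩q⁻; x∈p∪q⁻; p⊆p∪q; q⊆p∪q; x∉p⇒x∈∁p; x∈∁p⇒x∉p)
open import Data.Integer using (+[1+_]; +≤+) renaming (∣_∣ to absℤ)
open import Data.List using (List; []; _∷_; [_]; _++_; map; length; cartesianProductWith)
open import Data.List.Membership.Propositional using () renaming (_∈_ to _∈ₗ_)
open import Data.List.Membership.Propositional.Properties
  using (∈-map⁺; ∈-++⁺ˡ; ∈-++⁺ʳ; ∈-cartesianProductWith⁺)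
open import Data.List.Properties using (length-map; length-++)
open import Data.List.Relation.Unary.Any using (here)
open import Data.Nat using (ℕ; zero; suc; z≤n; s≤s; _+_; _*_; _^_; _≤_; _<_; _≤?_; NonZero)
open import Data.Nat.Properties
open import Data.Product using (∃-syntax; _×_; _,_; proj₁)
open import Data.Rational as ℚ using (ℚ; mkℚ; ↥_; ↧ₙ_; Positive)
import Data.Rational.Properties as ℚₚ
open import Data.Rational.Unnormalised.Base using (*≤*)
open import Data.Rational.Unnormalised.Properties using (≤-respˡ-≃)
open import Data.Sum using (_⊎_; inj₁; inj₂)
open import Data.Vec using ([]; _∷_; tabulate)
open import Data.Vec.Properties using ([]=⇒lookup; lookup⇒[]=; lookup∘tabulate)
open import Function using (_∘_)
open import Function.Definitions using (Injective)
open import Level using (Level)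
open import Relation.Binary.PropositionalEquality
  using (_≡_; refl; sym; trans; cong; cong₂; subst; module ≡-Reasoning)
open import Relation.Nullary using (does; yes; no; _×-dec_)
open import Relation.Nullary.Decidable using (dec-true)
open import Relation.Unary using (Pred; Decidable)

private variable
  ℓ : Level
  a b k A A′ B m m′ p p′ q q′ x y : ℕ

^-distribʳ-* : ∀ a b k → (a * b) ^ k ≡ a ^ k * b ^ k
^-distribʳ-* a b zero    = refl
^-distribʳ-* a b (suc k) = begin
  a * b * (a * b) ^ k     ≡⟨ cong (a * b *_) (^-distribʳ-* a b k) ⟩
  a * b * (a ^ k * b ^ k) ≡⟨ [m*n]*[o*p]≡[m*o]*[n*p] a b (a ^ k) (b ^ k) ⟩
  a * a ^ k * (b * b ^ k) ∎
  where open ≡-Reasoning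

^-cancelˡ-≤ : ∀ k .{{_ : NonZero k}} → a ^ k ≤ b ^ k → a ≤ b
^-cancelˡ-≤ {a} {b} k aᵏ≤bᵏ with a ≤? b
... | yes a≤b = a≤b
... | no  a≰b = ⊥-elim (<⇒≱ (^-monoˡ-< k (≰⇒> a≰b)) aᵏ≤bᵏ)

-- The root-free bound "x ≤ A · m^(p/q)", i.e. x^q ≤ A^q · m^p.
record PowLe (A m p q x : ℕ) : Set where
  constructor powLe
  field bound : x ^ q ≤ A ^ q * m ^ p

bound-^ : ∀ A m p q k → (A ^ q * m ^ p) ^ k ≡ A ^ (q * k) * m ^ (p * k)
bound-^ A m p q k = begin
  (A ^ q * m ^ p) ^ k       ≡⟨ ^-distribʳ-* (A ^ q) (m ^ p) k ⟩
  (A ^ q) ^ k * (m ^ p) ^ k ≡⟨ cong₂ _*_ (^-*-assoc A q k) (^-*-assoc m p k) ⟩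
  A ^ (q * k) * m ^ (p * k) ∎
  where open ≡-Reasoning

powLe-mono : x ≤ y → A ≤ A′ → m ≤ m′ → PowLe A m p q y → PowLe A′ m′ p q x
powLe-mono {x} {y} {A} {A′} {m} {m′} {p} {q} x≤y A≤A′ m≤m′ (powLe yᵠ≤) = powLe (begin
  x ^ q           ≤⟨ ^-monoˡ-≤ q x≤y ⟩
  y ^ q           ≤⟨ yᵠ≤ ⟩
  A ^ q * m ^ p   ≤⟨ *-mono-≤ (^-monoˡ-≤ q A≤A′) (^-monoˡ-≤ p m≤m′) ⟩
  A′ ^ q * m′ ^ p ∎)
  where open ≤-Reasoning

powLe-scale : ∀ k → PowLe A m p q x → PowLe A m (p * k) (q * k) x
powLe-scale {A} {m} {p} {q} {x} k (powLe xᵠ≤) = powLe (begin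
  x ^ (q * k)               ≡⟨ ^-*-assoc x q k ⟨
  (x ^ q) ^ k               ≤⟨ ^-monoˡ-≤ k xᵠ≤ ⟩
  (A ^ q * m ^ p) ^ k       ≡⟨ bound-^ A m p q k ⟩
  A ^ (q * k) * m ^ (p * k) ∎)
  where open ≤-Reasoning

powLe-unscale : ∀ k .{{_ : NonZero k}} → PowLe A m (p * k) (q * k) x → PowLe A m p q x
powLe-unscale {A} {m} {p} {q} {x} k (powLe xᵠᵏ≤) = powLe (^-cancelˡ-≤ k (begin
  (x ^ q) ^ k               ≡⟨ ^-*-assoc x q k ⟩
  x ^ (q * k)               ≤⟨ xᵠᵏ≤ ⟩
  A ^ (q * k) * m ^ (p * k) ≡⟨ bound-^ A m p q k ⟨
  (A ^ q * m ^ p) ^ k       ∎))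
  where open ≤-Reasoning

powLe-cong-q : q ≡ q′ → PowLe A m p q x → PowLe A m p q′ x
powLe-cong-q refl x≤ = x≤

powLe-weaken : .{{_ : NonZero m}} → p ≤ p′ → PowLe A m p q x → PowLe A m p′ q x
powLe-weaken {m} {A = A} {q = q} p≤p′ (powLe xᵠ≤) =
  powLe (≤-trans xᵠ≤ (*-monoʳ-≤ (A ^ q) (^-monoʳ-≤ m p≤p′)))

powLe-*-same : PowLe A m p q x → PowLe B m p′ q y → PowLe (A * B) m (p + p′) q (x * y)
powLe-*-same {A} {m} {p} {q} {x} {B} {p′} {y} (powLe xᵠ≤) (powLe yᵠ≤) = powLe (begin
  (x * y) ^ q                        ≡⟨ ^-distribʳ-* x y q ⟩
  x ^ q * y ^ q                      ≤⟨ *-mono-≤ xᵠ≤ yᵠ≤ ⟩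
  (A ^ q * m ^ p) * (B ^ q * m ^ p′) ≡⟨ [m*n]*[o*p]≡[m*o]*[n*p] (A ^ q) (m ^ p) (B ^ q) (m ^ p′) ⟩
  (A ^ q * B ^ q) * (m ^ p * m ^ p′) ≡⟨ cong₂ _*_ (^-distribʳ-* A B q) (^-distribˡ-+-* m p p′) ⟨
  (A * B) ^ q * m ^ (p + p′)         ∎)
  where open ≤-Reasoning

-- General product: p/q + p′/q′ = (p·q′ + p′·q)/(q·q′).
powLe-* : PowLe A m p q x → PowLe B m p′ q′ y →
          PowLe (A * B) m (p * q′ + p′ * q) (q * q′) (x * y)
powLe-* {q = q} {q′ = q′} x≤ y≤ =
  powLe-*-same (powLe-scale q′ x≤) (powLe-cong-q (*-comm q′ q) (powLe-scale q y≤))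

powLe-zero : .{{_ : NonZero q}} → PowLe A m p q 0
powLe-zero {suc q} = powLe z≤n

powLe-zero-base : .{{_ : NonZero q}} → 0 < p → PowLe A 0 p q x → x ≡ 0
powLe-zero-base {q} {suc p} {A} {x} _ (powLe xᵠ≤) =
  m^n≡0⇒m≡0 x q (n≤0⇒n≡0 (subst (x ^ q ≤_) (*-zeroʳ (A ^ q)) xᵠ≤))

-- A positive exponent may be replaced by any larger one, p/q ≤ p′/q′.
-- The base 0 is treated separately, since there m ↦ m^e is not monotone.
powLe-exponent : .{{_ : NonZero q}} .{{_ : NonZero q′}} → 0 < p → p * q′ ≤ p′ * q →
                 PowLe A m p q x → PowLe A m p′ q′ x
powLe-exponent {m = zero} 0<p _ x≤ with refl ← powLe-zero-base 0<p x≤ = powLe-zero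
powLe-exponent {q} {q′} {m = suc _} _ cross x≤ =
  powLe-unscale q (powLe-cong-q (*-comm q q′) (powLe-weaken cross (powLe-scale q′ x≤)))

logBound⇒powLe : ∀ d → 2 ^ (q * d) ≤ m ^ p → PowLe 1 m p q (2 ^ d)
logBound⇒powLe {q} {m} {p} d 2ᵠᵈ≤ = powLe (begin
  (2 ^ d) ^ q   ≡⟨ trans (^-*-assoc 2 d q) (cong (2 ^_) (*-comm d q)) ⟩
  2 ^ (q * d)   ≤⟨ 2ᵠᵈ≤ ⟩
  m ^ p         ≡⟨ sym (trans (cong (_* m ^ p) (^-zeroˡ q)) (*-identityˡ (m ^ p))) ⟩
  1 ^ q * m ^ p ∎)
  where open ≤-Reasoning

num den : ℚ → ℕ
num r = absℤ (↥ r)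
den r = ↧ₙ r

PowLeℚ : ℕ → ℕ → ℚ → ℕ → Set
PowLeℚ A m r x = PowLe A m (num r) (den r) x

-- r + s ≤ t for positive rationals, cross-multiplied in ℕ
-- (non-positive numerators are ruled out by the Positive hypotheses).
cross-multiply : ∀ r s t → Positive r → Positive s → Positive t → r ℚ.+ s ℚ.≤ t →
  (num r * den s + num s * den r) * den t ≤ num t * (den r * den s)
cross-multiply r@(mkℚ +[1+ _ ] _ _) s@(mkℚ +[1+ _ ] _ _) (mkℚ +[1+ _ ] _ _) _ _ _ r+s≤t
  with *≤* (+≤+ le) ← ≤-respˡ-≃ (ℚₚ.toℚᵘ-homo-+ r s) (ℚₚ.toℚᵘ-mono-≤ r+s≤t) = le

cross-numerator-pos : ∀ r s → Positive r → 0 < num r * den s + num s * den r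
cross-numerator-pos (mkℚ +[1+ _ ] _ _) _ _ = s≤s z≤n

powLeℚ-* : ∀ {r s t} → Positive r → Positive s → r ℚ.+ s ℚ.≤ t →
           PowLeℚ A m r x → PowLeℚ B m s y → PowLeℚ (A * B) m t (x * y)
powLeℚ-* {r = r} {s} {t} pos-r pos-s r+s≤t x≤ y≤ =
  powLe-exponent (cross-numerator-pos r s pos-r) (cross-multiply r s t pos-r pos-s pos-t r+s≤t)
    (powLe-* x≤ y≤)
  where
  pos-t : Positive t
  pos-t = ℚ.positive (ℚₚ.<-≤-trans (ℚₚ.+-mono-< (ℚₚ.positive⁻¹ r {{pos-r}}) (ℚₚ.positive⁻¹ s {{pos-s}})) r+s≤t)

upper-positive : (c : PosReal) → ∀ {r} → Upper c r → Positive r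
upper-positive c {r} r∈c with positive c
... | q , 0<q , q≤upper = ℚ.positive (ℚₚ.<-≤-trans 0<q (q≤upper r r∈c))

subsetsOf : Subset k → List (Subset k)
subsetsOf []            = [ [] ]
subsetsOf (inside ∷ D)  = map (inside ∷_) (subsetsOf D) ++ map (outside ∷_) (subsetsOf D)
subsetsOf (outside ∷ D) = map (outside ∷_) (subsetsOf D)

length-subsetsOf : ∀ (D : Subset k) → length (subsetsOf D) ≡ 2 ^ ∣ D ∣
length-subsetsOf []            = refl
length-subsetsOf (inside ∷ D)  = begin
  length (map (inside ∷_) (subsetsOf D) ++ map (outside ∷_) (subsetsOf D))
    ≡⟨ length-++ (map (inside ∷_) (subsetsOf D)) ⟩
  length (map (inside ∷_) (subsetsOf D)) + length (map (outside ∷_) (subsetsOf D))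
    ≡⟨ cong₂ _+_ (length-map (inside ∷_) (subsetsOf D)) (length-map (outside ∷_) (subsetsOf D)) ⟩
  length (subsetsOf D) + length (subsetsOf D)
    ≡⟨ cong₂ _+_ (length-subsetsOf D) (trans (length-subsetsOf D) (sym (+-identityʳ _))) ⟩
  2 ^ ∣ D ∣ + (2 ^ ∣ D ∣ + 0) ∎
  where open ≡-Reasoning
length-subsetsOf (outside ∷ D) = trans (length-map (outside ∷_) (subsetsOf D)) (length-subsetsOf D)

∩-∈-subsetsOf : ∀ (K D : Subset k) → K ∩ D ∈ₗ subsetsOf D
∩-∈-subsetsOf []            []            = here refl
∩-∈-subsetsOf (inside  ∷ K) (inside  ∷ D) = ∈-++⁺ˡ (∈-map⁺ (inside ∷_) (∩-∈-subsetsOf K D))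
∩-∈-subsetsOf (outside ∷ K) (inside  ∷ D) =
  ∈-++⁺ʳ (map (inside ∷_) (subsetsOf D)) (∈-map⁺ (outside ∷_) (∩-∈-subsetsOf K D))
∩-∈-subsetsOf (inside  ∷ K) (outside ∷ D) = ∈-map⁺ (outside ∷_) (∩-∈-subsetsOf K D)
∩-∈-subsetsOf (outside ∷ K) (outside ∷ D) = ∈-map⁺ (outside ∷_) (∩-∈-subsetsOf K D)

length-cartesianProductWith : ∀ {A B C : Set} (f : A → B → C) xs ys →
  length (cartesianProductWith f xs ys) ≡ length xs * length ys
length-cartesianProductWith f []       ys = refl
length-cartesianProductWith f (x ∷ xs) ys = begin
  length (map (f x) ys ++ cartesianProductWith f xs ys)
    ≡⟨ length-++ (map (f x) ys) ⟩
  length (map (f x) ys) + length (cartesianProductWith f xs ys)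
    ≡⟨ cong₂ _+_ (length-map (f x) ys) (length-cartesianProductWith f xs ys) ⟩
  length ys + length xs * length ys ∎
  where open ≡-Reasoning

⟦_⟧ : {P : Pred (Fin k) ℓ} → Decidable P → Subset k
⟦ P? ⟧ = tabulate λ v → does (P? v)

∈⟦⟧⁺ : ∀ {P : Pred (Fin k) ℓ} (P? : Decidable P) {v} → P v → v ∈ ⟦ P? ⟧
∈⟦⟧⁺ P? {v} pv = lookup⇒[]= v ⟦ P? ⟧ (trans (lookup∘tabulate _ v) (dec-true (P? v) pv))

∈⟦⟧⁻ : ∀ {P : Pred (Fin k) ℓ} (P? : Decidable P) {v} → v ∈ ⟦ P? ⟧ → P v
∈⟦⟧⁻ P? {v} v∈ with P? v | trans (sym (lookup∘tabulate (λ u → does (P? u)) v)) ([]=⇒lookup v∈)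
... | yes pv | _  = pv
... | no  _  | ()

module Lift {G H : Graph} {D : Subset (n G)} (f : Fin (n H) → Fin (n G))
  (f-inj : Injective _≡_ _≡_ f) (f-onto : ∀ v → v ∉ D → ∃[ i ] (f i ≡ v))
  (f-adj : ∀ i j → adj H i j ≡ adj G (f i) (f j)) where

  preimage : Subset (n G) → Subset (n H)
  preimage K = ⟦ (λ i → f i ∈? K) ⟧

  image : Subset (n H) → Subset (n G)
  image W = ⟦ (λ v → any? λ i → (i ∈? W) ×-dec (f i ≟ᶠ v)) ⟧

  ∈-preimage⁺ : ∀ {K i} → f i ∈ K → i ∈ preimage K
  ∈-preimage⁺ {K} = ∈⟦⟧⁺ (λ i → f i ∈? K)

  ∈-preimage⁻ : ∀ {K i} → i ∈ preimage K → f i ∈ K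
  ∈-preimage⁻ {K} = ∈⟦⟧⁻ (λ i → f i ∈? K)

  ∈-image⁺ : ∀ {W i} → i ∈ W → f i ∈ image W
  ∈-image⁺ {W} i∈W = ∈⟦⟧⁺ (λ v → any? λ j → (j ∈? W) ×-dec (f j ≟ᶠ v)) (_ , i∈W , refl)

  ∈-image⁻ : ∀ {W v} → v ∈ image W → ∃[ i ] (i ∈ W × f i ≡ v)
  ∈-image⁻ {W} = ∈⟦⟧⁻ (λ v → any? λ j → (j ∈? W) ×-dec (f j ≟ᶠ v))

  preimage-clique : ∀ {K} → IsClique G K → IsClique H (preimage K)
  preimage-clique clique u v u∈ v∈ u≢v = trans (f-adj u v)
    (clique (f u) (f v) (∈-preimage⁻ u∈) (∈-preimage⁻ v∈) (u≢v ∘ f-inj))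

  preimage-stable : ∀ {S} → IsStable G S → IsStable H (preimage S)
  preimage-stable stable u v u∈ v∈ =
    trans (f-adj u v) (stable (f u) (f v) (∈-preimage⁻ u∈) (∈-preimage⁻ v∈))

  lift : Subset (n G) → Subset (n H) → Subset (n G)
  lift T W = T ∪ image W

  -- If W separates the pulled-back pair, then lift (K ∩ D) W separates (K, S):
  -- vertices of K in D lie in K ∩ D, the others are images of vertices of W,
  -- and S meets neither K nor the image of W.
  lift-separates : ∀ {K S W} → (∀ v → v ∈ K → v ∉ S) →
    Separates H W (preimage K) (preimage S) → Separates G (lift (K ∩ D) W) K S
  lift-separates {K} {S} {W} K∩S=∅ (K⊆W , S⊆∁W) = K⊆lift , S⊆∁lift
    where
    K⊆lift : ∀ v → v ∈ K → v ∈ lift (K ∩ D) W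
    K⊆lift v v∈K with v ∈? D
    ... | yes v∈D = p⊆p∪q (image W) (x∈p∩q⁺ (v∈K , v∈D))
    ... | no  v∉D with f-onto v v∉D
    ... | i , refl = q⊆p∪q (K ∩ D) (image W) (∈-image⁺ (K⊆W i (∈-preimage⁺ v∈K)))

    S-avoids-lift : ∀ {v} → v ∈ S → v ∈ K ∩ D ⊎ v ∈ image W → ⊥
    S-avoids-lift v∈S (inj₁ v∈K∩D) = K∩S=∅ _ (proj₁ (x∈p∩q⁻ K D v∈K∩D)) v∈S
    S-avoids-lift v∈S (inj₂ v∈img) with ∈-image⁻ v∈img
    ... | i , i∈W , refl = x∈∁p⇒x∉p (S⊆∁W i (∈-preimage⁺ v∈S)) i∈W

    S⊆∁lift : ∀ v → v ∈ S → v ∈ ∁ (lift (K ∩ D) W)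
    S⊆∁lift v v∈S = x∉p⇒x∈∁p (S-avoids-lift v∈S ∘ x∈p∪q⁻ (K ∩ D) (image W))

  liftedCuts : List (Subset (n H)) → List (Subset (n G))
  liftedCuts F = cartesianProductWith (λ W T → lift T W) F (subsetsOf D)

  length-liftedCuts : ∀ F → length (liftedCuts F) ≡ length F * 2 ^ ∣ D ∣
  length-liftedCuts F = trans (length-cartesianProductWith _ F (subsetsOf D))
                              (cong (length F *_) (length-subsetsOf D))

  liftedCuts-separator : ∀ {F} → IsCSSeparator H F → IsCSSeparator G (liftedCuts F)
  liftedCuts-separator sepH K S clique stable K∩S=∅
    with sepH (preimage K) (preimage S) (preimage-clique clique) (preimage-stable stable)
              (λ i i∈K i∈S → K∩S=∅ (f i) (∈-preimage⁻ i∈K) (∈-preimage⁻ i∈S))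
  ... | W , W∈F , W-separates =
    lift (K ∩ D) W , ∈-cartesianProductWith⁺ _ W∈F (∩-∈-subsetsOf K D) ,
    lift-separates K∩S=∅ W-separates

lemma6 : (c c' : PosReal) (𝒞 𝒞' : Graph → Set) →
         HasCSSeparation 𝒞' (Upper c') →
         AtLogDistance 𝒞 𝒞' c →
         HasCSSeparation 𝒞 (SumUpper c' c)
lemma6 c c' 𝒞 𝒞' (A , separation′) distance = A , separation
  where
  separation : ∀ G → 𝒞 G →
    ∃[ F ] (IsCSSeparator G F × PowBound (SumUpper c' c) A (n G) (length F))
  separation G G∈𝒞 with distance G G∈𝒞
  ... | D , D-small , H , H∈𝒞′ , f , f-inj , _ , f-onto , f-adj with separation′ H H∈𝒞′
  ... | F , F-separator , F-small =
    liftedCuts F , liftedCuts-separator F-separator , size-bound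
    where
    open Lift {G} {H} {D} f f-inj f-onto f-adj
    size-bound : PowBound (SumUpper c' c) A (n G) (length (liftedCuts F))
    size-bound t (r , s , r∈c′ , s∈c , r+s≤t) = PowLe.bound
      (powLe-mono (≤-reflexive (length-liftedCuts F)) (≤-reflexive (*-identityʳ A)) ≤-refl product)
      where
      F-bound : PowLeℚ A (n G) r (length F)
      F-bound = powLe-mono ≤-refl ≤-refl (injective⇒≤ f-inj) (powLe (F-small r r∈c′))
      D-bound : PowLeℚ 1 (n G) s (2 ^ ∣ D ∣)
      D-bound = logBound⇒powLe ∣ D ∣ (D-small s s∈c)
      product : PowLeℚ (A * 1) (n G) t (length F * 2 ^ ∣ D ∣)
      product = powLeℚ-* {r = r} {s} {t} (upper-positive c' r∈c′) (upper-positive c s∈c) r+s≤t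
                  F-bound D-bound
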